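{- Let $q$ be a prime power. No four triangles in $\mathscr{T}_q$ are the four triangles of a single copy of $K_4$ in $H_q$.
   Context: For a prime power $q$, let $PG(2,q^2)$ be the projective plane over $\mathbb{F}_{q^2}$, whose points are the one-dimensional subspaces $\langle X,Y,Z\rangle$ of $\mathbb{F}_{q^2}^3$. The Hermitian unital is $\mathscr{U}_q=\{\langle X,Y,Z\rangle : X^{q+1}+Y^{q+1}+Z^{q+1}=0\}$. Every line of $PG(2,q^2)$ meets $\mathscr{U}_q$ in either exactly $1$ or exactly $q+1$ points; lines of the latter kind are called secants, and $\mathscr{L}_q$ denotes the set of secants. $H_q$ is the graph with vertex set $\{v_\ell : \ell\in\mathscr{L}_q\}$, where $v_{\ell_1}\sim v_{\ell_2}$ iff $\ell_1\neq\ell_2$ and $\ell_1\cap\ell_2\in\mathscr{U}_q$. A triangle $v_{\ell_1}v_{\ell_2}v_{\ell_3}$ of $H_q$ is non-degenerate if the three points $\ell_1\cap\ell_2$, $\ell_2\cap\ell_3$, $\ell_1\cap\ell_3$ are pairwise distinct; $\mathscr{T}_q$ is the set of non-degenerate triangles of $H_q$. -}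

module Defs where

open import Level using (Level; _⊔_) renaming (suc to lsuc)
open import Algebra.Bundles using (CommutativeRing)
import Algebra.Bundles
import Algebra.Definitions.RawSemiring as RawSemiringDefs
open import Data.Nat using (ℕ; suc) renaming (_^_ to _^ℕ_)
open import Data.Nat.Primality using (Prime)
open import Data.Fin using (Fin)
open import Data.Product using (Σ; ∃; ∃₂; _×_; _,_)
open import Relation.Nullary using (¬_)
open import Relation.Binary.PropositionalEquality using (_≡_)

IsPrimePower : ℕ → Set
IsPrimePower q = ∃₂ λ p k → Prime p × q ≡ p ^ℕ suc k

record Field (c ℓ : Level) : Set (lsuc (c ⊔ ℓ)) where
  field
    commutativeRing : CommutativeRing c ℓ
  open CommutativeRing commutativeRing public
  field
    0≉1     : ¬ (0# ≈ 1#)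
    inverse : ∀ x → ¬ (x ≈ 0#) → ∃ λ y → x * y ≈ 1#

HasSize : ∀ {c ℓ} → Field c ℓ → ℕ → Set (c ⊔ ℓ)
HasSize F n = Σ (Fin n → Carrier) λ f →
                 (∀ i j → f i ≈ f j → i ≡ j) × (∀ x → ∃ λ i → f i ≈ x)
  where open Field F

-- Geometry of PG(2, F) and the Hermitian curve X^{q+1}+Y^{q+1}+Z^{q+1}=0,
-- for a field F (intended: F = F_{q^2}).
module Hermitian {c ℓ} (F : Field c ℓ) (q : ℕ) where
  open Field F
  open RawSemiringDefs (Algebra.Bundles.Semiring.rawSemiring semiring) using (_^_)

  -- vectors of F^3 (homogeneous coordinates of points, and of lines)
  record V3 : Set c where
    constructor ⟨_,_,_⟩
    field
      x y z : Carrier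
  open V3 public

  NonZero : V3 → Set ℓ
  NonZero v = ¬ (x v ≈ 0# × y v ≈ 0# × z v ≈ 0#)

  -- same projective point / line: v = λ w for some nonzero scalar λ
  Prop : V3 → V3 → Set (c ⊔ ℓ)
  Prop v w = ∃ λ k → ¬ (k ≈ 0#) × (x v ≈ k * x w) × (y v ≈ k * y w) × (z v ≈ k * z w)

  On : V3 → V3 → Set ℓ
  On P L = x L * x P + y L * y P + z L * z P ≈ 0#

  InU : V3 → Set ℓ
  InU P = NonZero P × (x P ^ suc q + y P ^ suc q + z P ^ suc q ≈ 0#)

  Line : V3 → Set ℓ
  Line L = NonZero L

  -- L is a secant: a line meeting U_q in more than one point
  -- (since every line meets U_q in 1 or q+1 points, these are the lines meeting it in q+1 points)
  Secant : V3 → Set (c ⊔ ℓ)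
  Secant L = Line L × ∃₂ λ P Q → InU P × InU Q × On P L × On Q L × ¬ Prop P Q

  Meet : V3 → V3 → V3 → Set ℓ
  Meet L M P = NonZero P × On P L × On P M

  Adj : V3 → V3 → Set (c ⊔ ℓ)
  Adj L M = ¬ Prop L M × ∃ λ P → Meet L M P × InU P

  Triangle : V3 → V3 → V3 → Set (c ⊔ ℓ)
  Triangle L M N = Secant L × Secant M × Secant N × Adj L M × Adj M N × Adj L N

  NonDegenerate : V3 → V3 → V3 → Set (c ⊔ ℓ)
  NonDegenerate L M N =
    ∃ λ P₁₂ → ∃ λ P₂₃ → ∃ λ P₁₃ →
      Meet L M P₁₂ × Meet M N P₂₃ × Meet L N P₁₃ ×
      ¬ Prop P₁₂ P₂₃ × ¬ Prop P₂₃ P₁₃ × ¬ Prop P₁₂ P₁₃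

  InT : V3 → V3 → V3 → Set (c ⊔ ℓ)
  InT L M N = Triangle L M N × NonDegenerate L M N

  -- four secants forming a copy of K₄ in H_q (pairwise adjacent, hence pairwise distinct)
  K4 : V3 → V3 → V3 → V3 → Set (c ⊔ ℓ)
  K4 L₁ L₂ L₃ L₄ = Secant L₁ × Secant L₂ × Secant L₃ × Secant L₄ ×
                   Adj L₁ L₂ × Adj L₁ L₃ × Adj L₁ L₄ ×
                   Adj L₂ L₃ × Adj L₂ L₄ × Adj L₃ L₄

{-# OPTIONS --safe #-}
module Submission where

-- Let the secants be L₁, …, L₄ and put a = L₂∩L₃, b = L₁∩L₃, c = L₁∩L₂, d = L₁∩L₄,
-- e = L₂∩L₄, f = L₃∩L₄. Then abc is a triangle, d, e, f lie on its sides bc, ca, ab and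
-- on the common line L₄, and all six points are isotropic for h(u, v) = Σ uᵢ v̄ᵢ, where
-- x̄ = x^q is a ring endomorphism because the characteristic of F_{q²} divides q.
-- Writing d = μb + νc, e = ρc + τa, f = φa + ψb up to scalars, Menelaus gives
-- μρφ + ντψ = 0, and isotropy of d gives μν̄ h(b,c) + νμ̄ h(c,b) = 0, similarly for e, f.
-- Multiplying these three relations and using Menelaus and its conjugate yields
-- ντψ·ν̄τ̄ψ̄·(h(a,b)h(b,c)h(c,a) + h(b,a)h(c,b)h(a,c)) = 0. The bracket is the Gram
-- determinant of the isotropic a, b, c, that is Δ·Δ̄ with Δ = det(a,b,c) ≠ 0, while
-- ν, τ, ψ ≠ 0 because d ≠ b, e ≠ c, f ≠ a: a contradiction. Non-degeneracy of the four
-- triangles supplies exactly these distinctness conditions.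

open import Algebra.Bundles using (CommutativeRing; CommutativeSemiring)
open import Defs
open import Data.Nat using (ℕ)
open import Relation.Binary.Definitions using (Decidable)

-- The ring solver over R with coefficients in ℤ, so that cancellations such as x - x = 0
-- are decided by computation in ℤ rather than in the abstract carrier.
module IntegerSolver {c ℓ} (R : CommutativeRing c ℓ) where

  open import Data.Nat as ℕ using (zero; suc)
  import Data.Nat.Properties as ℕ
  open import Data.Integer as ℤ using (ℤ; +_; -[1+_]; _⊖_; sign; ∣_∣; _◃_)
  import Data.Integer.Properties as ℤ
  open import Data.Sign as Sign using (Sign)
  open import Data.Maybe using (Maybe; just; nothing)
  open import Relation.Nullary using (yes; no)
  import Relation.Binary.PropositionalEquality as ≡
  open CommutativeRing R hiding (zero)
  open import Relation.Binary.Reasoning.Setoid setoid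
  open import Algebra.Properties.Ring ring using (-‿involutive; -0#≈0#; -‿+-comm; -1*x≈-x)
  open import Algebra.Properties.Semiring.Mult semiring using (_×_; ×-homo-+; ×1-homo-*)
  import Algebra.Properties.CommutativeSemigroup as CommutativeSemigroupProperties
  open import Algebra.Solver.Ring.AlmostCommutativeRing
    using (fromCommutativeRing; _-Raw-AlmostCommutative⟶_)

  fromℤ : ℤ → Carrier
  fromℤ (+ n)    = n × 1#
  fromℤ -[1+ n ] = - (suc n × 1#)

  fromSign : Sign → Carrier
  fromSign Sign.+ = 1#
  fromSign Sign.- = - 1#

  private
    open CommutativeSemigroupProperties +-commutativeSemigroup using () renaming (interchange to +-interchange)
    open CommutativeSemigroupProperties *-commutativeSemigroup using () renaming (interchange to *-interchange)

    fromℤ-homo-neg : ∀ i → fromℤ (ℤ.- i) ≈ - fromℤ i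
    fromℤ-homo-neg -[1+ n ]    = sym (-‿involutive _)
    fromℤ-homo-neg (+ zero)    = sym -0#≈0#
    fromℤ-homo-neg (+ suc n)   = refl

    x-y≈[1+x]-[1+y] : ∀ x y → x - y ≈ (1# + x) - (1# + y)
    x-y≈[1+x]-[1+y] x y = begin
      x - y                   ≈⟨ sym (+-identityˡ _) ⟩
      0# + (x - y)            ≈⟨ +-congʳ (sym (-‿inverseʳ 1#)) ⟩
      (1# - 1#) + (x - y)     ≈⟨ +-interchange 1# (- 1#) x (- y) ⟩
      (1# + x) + (- 1# - y)   ≈⟨ +-congˡ (-‿+-comm 1# y) ⟩
      (1# + x) - (1# + y)     ∎

    fromℤ-homo-⊖ : ∀ m n → fromℤ (m ⊖ n) ≈ m × 1# - n × 1#
    fromℤ-homo-⊖ m zero = begin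
      fromℤ (m ⊖ zero)   ≡⟨ ≡.cong fromℤ (ℤ.⊖-≥ {m} {0} ℕ.z≤n) ⟩
      m × 1#             ≈⟨ sym (+-identityʳ _) ⟩
      m × 1# + 0#        ≈⟨ +-congˡ (sym -0#≈0#) ⟩
      m × 1# - 0#        ∎
    fromℤ-homo-⊖ zero (suc n) = begin
      fromℤ (zero ⊖ suc n)   ≡⟨ ≡.cong fromℤ (ℤ.⊖-≤ {0} {suc n} ℕ.z≤n) ⟩
      - (suc n × 1#)         ≈⟨ sym (+-identityˡ _) ⟩
      0# - suc n × 1#        ∎
    fromℤ-homo-⊖ (suc m) (suc n) = begin
      fromℤ (suc m ⊖ suc n)         ≡⟨ ≡.cong fromℤ (ℤ.[1+m]⊖[1+n]≡m⊖n m n) ⟩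
      fromℤ (m ⊖ n)                 ≈⟨ fromℤ-homo-⊖ m n ⟩
      m × 1# - n × 1#               ≈⟨ x-y≈[1+x]-[1+y] _ _ ⟩
      suc m × 1# - suc n × 1#       ∎

    fromℤ-homo-+ : ∀ i j → fromℤ (i ℤ.+ j) ≈ fromℤ i + fromℤ j
    fromℤ-homo-+ -[1+ m ] -[1+ n ] = begin
      - (suc (suc (m ℕ.+ n)) × 1#)      ≡⟨ ≡.cong (λ k → - (k × 1#)) (≡.sym (ℕ.+-suc (suc m) n)) ⟩
      - ((suc m ℕ.+ suc n) × 1#)        ≈⟨ -‿cong (×-homo-+ 1# (suc m) (suc n)) ⟩
      - (suc m × 1# + suc n × 1#)       ≈⟨ sym (-‿+-comm _ _) ⟩
      - (suc m × 1#) - suc n × 1#       ∎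
    fromℤ-homo-+ -[1+ m ] (+ n)    = trans (fromℤ-homo-⊖ n (suc m)) (+-comm _ _)
    fromℤ-homo-+ (+ m)    -[1+ n ] = fromℤ-homo-⊖ m (suc n)
    fromℤ-homo-+ (+ m)    (+ n)    = ×-homo-+ 1# m n

    fromSign-homo-* : ∀ s t → fromSign (s Sign.* t) ≈ fromSign s * fromSign t
    fromSign-homo-* Sign.+ _      = sym (*-identityˡ _)
    fromSign-homo-* Sign.- Sign.+ = sym (*-identityʳ _)
    fromSign-homo-* Sign.- Sign.- = sym (trans (-1*x≈-x _) (-‿involutive _))

    fromℤ-◃ : ∀ s n → fromℤ (s ◃ n) ≈ fromSign s * (n × 1#)
    fromℤ-◃ s      zero    = sym (zeroʳ _)
    fromℤ-◃ Sign.+ (suc n) = sym (*-identityˡ _)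
    fromℤ-◃ Sign.- (suc n) = sym (-1*x≈-x _)

    fromℤ-sign-abs : ∀ i → fromℤ i ≈ fromSign (sign i) * (∣ i ∣ × 1#)
    fromℤ-sign-abs (+ zero)  = fromℤ-◃ Sign.+ zero
    fromℤ-sign-abs (+ suc n) = fromℤ-◃ Sign.+ (suc n)
    fromℤ-sign-abs -[1+ n ]  = fromℤ-◃ Sign.- (suc n)

    fromℤ-homo-* : ∀ i j → fromℤ (i ℤ.* j) ≈ fromℤ i * fromℤ j
    fromℤ-homo-* i j = begin
      fromℤ (i ℤ.* j)
        ≈⟨ fromℤ-◃ (sign i Sign.* sign j) (∣ i ∣ ℕ.* ∣ j ∣) ⟩
      fromSign (sign i Sign.* sign j) * ((∣ i ∣ ℕ.* ∣ j ∣) × 1#)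
        ≈⟨ *-cong (fromSign-homo-* (sign i) (sign j)) (×1-homo-* ∣ i ∣ ∣ j ∣) ⟩
      (fromSign (sign i) * fromSign (sign j)) * ((∣ i ∣ × 1#) * (∣ j ∣ × 1#))
        ≈⟨ *-interchange _ _ _ _ ⟩
      (fromSign (sign i) * (∣ i ∣ × 1#)) * (fromSign (sign j) * (∣ j ∣ × 1#))
        ≈⟨ sym (*-cong (fromℤ-sign-abs i) (fromℤ-sign-abs j)) ⟩
      fromℤ i * fromℤ j ∎

  fromℤ-morphism : ℤ.+-*-rawRing -Raw-AlmostCommutative⟶ fromCommutativeRing R
  fromℤ-morphism = record
    { ⟦_⟧    = fromℤ
    ; +-homo = fromℤ-homo-+
    ; *-homo = fromℤ-homo-*
    ; -‿homo = fromℤ-homo-neg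
    ; 0-homo = refl
    ; 1-homo = +-identityʳ 1#
    }

  fromℤ-≟ : ∀ i j → Maybe (fromℤ i ≈ fromℤ j)
  fromℤ-≟ i j with i ℤ.≟ j
  ... | yes i≡j = just (reflexive (≡.cong fromℤ i≡j))
  ... | no _    = nothing

  open import Algebra.Solver.Ring ℤ.+-*-rawRing (fromCommutativeRing R) fromℤ-morphism fromℤ-≟ public


module PrimeBinomial where

  open import Data.Nat as ℕ using (zero; suc; _<_; _∸_; _!)
  open import Data.Nat.Properties using (<⇒≤; <⇒≱; n<1+n; <-trans; ∸-monoʳ-<; _!*_!≢0)
  open import Data.Nat.Divisibility using (_∣_; ∣1⇒≡1; ∣⇒≤; m∣m*n)
  open import Data.Nat.Primality using (Prime; euclidsLemma; ¬prime[1])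
  open import Data.Nat.Combinatorics using (_C_; nCk≡n!/k![n-k]!; k![n∸k]!∣n!)
  open import Data.Nat.DivMod using (m*[n/m]≡n)
  open import Data.Sum using (inj₁; inj₂)
  open import Data.Empty using (⊥-elim)
  open import Relation.Nullary using (¬_)
  open import Relation.Binary.PropositionalEquality using (_≡_; subst; sym; trans; cong)

  prime∤m! : ∀ {p} → Prime p → ∀ m → m < p → ¬ p ∣ m !
  prime∤m! p-prime zero    _   p∣1 = ¬prime[1] (subst Prime (∣1⇒≡1 p∣1) p-prime)
  prime∤m! p-prime (suc m) m<p p∣m!
    with euclidsLemma (suc m) (m !) p-prime p∣m!
  ... | inj₁ p∣1+m = <⇒≱ m<p (∣⇒≤ p∣1+m)
  ... | inj₂ p∣m!  = prime∤m! p-prime m (<-trans (n<1+n m) m<p) p∣m!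

  prime∣pCk : ∀ {p k} → Prime p → 0 < k → k < p → p ∣ p C k
  prime∣pCk {p@(suc p-1)} {k} p-prime 0<k k<p
    with euclidsLemma (k ! ℕ.* (p ∸ k) !) (p C k) p-prime p∣k![p-k]!*pCk
    where
    instance _ = k !* (p ∸ k) !≢0
    k![p-k]!*pCk≡p! : k ! ℕ.* (p ∸ k) ! ℕ.* (p C k) ≡ p !
    k![p-k]!*pCk≡p! = trans (cong (k ! ℕ.* (p ∸ k) ! ℕ.*_) (nCk≡n!/k![n-k]! (<⇒≤ k<p)))
                            (m*[n/m]≡n (k![n∸k]!∣n! (<⇒≤ k<p)))
    p∣k![p-k]!*pCk : p ∣ k ! ℕ.* (p ∸ k) ! ℕ.* (p C k)
    p∣k![p-k]!*pCk = subst (p ∣_) (sym k![p-k]!*pCk≡p!) (m∣m*n (p-1 !))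
  ... | inj₂ p∣pCk = p∣pCk
  ... | inj₁ p∣k![p-k]! with euclidsLemma (k !) ((p ∸ k) !) p-prime p∣k![p-k]!
  ...   | inj₁ p∣k!     = ⊥-elim (prime∤m! p-prime k k<p p∣k!)
  ...   | inj₂ p∣[p-k]! = ⊥-elim (prime∤m! p-prime (p ∸ k) (∸-monoʳ-< 0<k (<⇒≤ k<p)) p∣[p-k]!)


module Frobenius {c ℓ} (S : CommutativeSemiring c ℓ) where

  open import Data.Nat as ℕ using (zero; suc; _<_; s≤s; z≤n)
  import Data.Nat.Properties as ℕ
  open import Data.Nat.Divisibility using (divides)
  open import Data.Nat.Primality using (Prime; ¬prime[0]; ¬prime[1])
  open import Data.Nat.Combinatorics using (_C_; nCn≡1)
  open import Data.Fin as Fin using (Fin; toℕ; inject₁; fromℕ)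
  open import Data.Fin.Properties using (toℕ-inject₁; toℕ<n; toℕ-fromℕ)
  open import Data.Empty using (⊥-elim)
  open import Relation.Binary.PropositionalEquality as ≡ using (_≡_)
  open CommutativeSemiring S
  open import Algebra.Properties.Semiring.Mult semiring
  open import Algebra.Properties.Semiring.Exp semiring
  open import Algebra.Properties.Semiring.Sum semiring
  open import Algebra.Properties.CommutativeSemiring.Binomial S
  open import Relation.Binary.Reasoning.Setoid setoid
  open PrimeBinomial using (prime∣pCk)

  sum-vanishing-interior : ∀ m (t : Fin (suc (suc m)) → Carrier) →
                           (∀ i → t (Fin.suc (inject₁ i)) ≈ 0#) →
                           sum t ≈ t Fin.zero + t (fromℕ (suc m))
  sum-vanishing-interior m t interior≈0 = +-congˡ (begin
    sum (λ i → t (Fin.suc i))                             ≈⟨ sum-init-last (λ i → t (Fin.suc i)) ⟩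
    sum (λ i → t (Fin.suc (inject₁ i))) + t (fromℕ (suc m)) ≈⟨ +-congʳ (trans (sum-cong-≋ interior≈0) (sum-replicate-zero m)) ⟩
    0# + t (fromℕ (suc m))                                 ≈⟨ +-identityˡ _ ⟩
    t (fromℕ (suc m))                                      ∎)

  [m*p]×x≈0 : ∀ {p} → p × 1# ≈ 0# → ∀ m x → (m ℕ.* p) × x ≈ 0#
  [m*p]×x≈0 {p} p×1≈0 m x = begin
    (m ℕ.* p) × x        ≡⟨ ≡.cong (_× x) (ℕ.*-comm m p) ⟩
    (p ℕ.* m) × x        ≈⟨ sym (×-assocˡ x p m) ⟩
    p × (m × x)          ≈⟨ ×-congʳ p (sym (*-identityˡ _)) ⟩
    p × (1# * (m × x))   ≈⟨ sym (×-assoc-* p 1# (m × x)) ⟩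
    (p × 1#) * (m × x)   ≈⟨ *-congʳ p×1≈0 ⟩
    0# * (m × x)         ≈⟨ zeroˡ _ ⟩
    0#                   ∎

  ^p-homo-+ : ∀ {p} → Prime p → p × 1# ≈ 0# → ∀ x y → (x + y) ^ p ≈ x ^ p + y ^ p
  ^p-homo-+ {0} p-prime _ = ⊥-elim (¬prime[0] p-prime)
  ^p-homo-+ {1} p-prime _ = ⊥-elim (¬prime[1] p-prime)
  ^p-homo-+ {p@(suc (suc m))} p-prime p×1≈0 x y = begin
    (x + y) ^ p                                          ≈⟨ theorem p x y ⟩
    binomialExpansion x y p                              ≈⟨ sum-vanishing-interior (suc m) (binomialTerm x y p) interior≈0 ⟩
    binomialTerm x y p Fin.zero + binomialTerm x y p (fromℕ p) ≈⟨ +-cong first≈y^p (last≈x^p (toℕ (fromℕ p)) (toℕ-fromℕ p)) ⟩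
    y ^ p + x ^ p                                        ≈⟨ +-comm _ _ ⟩
    x ^ p + y ^ p                                        ∎
    where
    interior≈0 : ∀ i → binomialTerm x y p (Fin.suc (inject₁ i)) ≈ 0#
    interior≈0 i with prime∣pCk p-prime (s≤s z≤n) (s≤s (≡.subst (_< suc m) (≡.sym (toℕ-inject₁ i)) (toℕ<n i)))
    ... | divides r pCj≡r*p = trans (×-congˡ pCj≡r*p) ([m*p]×x≈0 p×1≈0 r _)
    first≈y^p : binomialTerm x y p Fin.zero ≈ y ^ p
    first≈y^p = trans (+-identityʳ _) (*-identityˡ _)
    last≈x^p : ∀ j → j ≡ p → (p C j) × (x ^ j * y ^ (p ℕ.∸ j)) ≈ x ^ p
    last≈x^p j ≡.refl rewrite nCn≡1 p | ℕ.n∸n≡0 p = trans (+-identityʳ _) (*-identityʳ _)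

  ^p^k-homo-+ : ∀ {p} → Prime p → p × 1# ≈ 0# → ∀ k x y → (x + y) ^ (p ℕ.^ k) ≈ x ^ (p ℕ.^ k) + y ^ (p ℕ.^ k)
  ^p^k-homo-+ p-prime p×1≈0 zero    x y = trans (*-identityʳ _) (+-cong (sym (*-identityʳ _)) (sym (*-identityʳ _)))
  ^p^k-homo-+ {p} p-prime p×1≈0 (suc k) x y = begin
    (x + y) ^ (p ℕ.* p ℕ.^ k)                   ≈⟨ sym (^-assocʳ (x + y) p (p ℕ.^ k)) ⟩
    ((x + y) ^ p) ^ (p ℕ.^ k)                   ≈⟨ ^-congˡ (p ℕ.^ k) (^p-homo-+ p-prime p×1≈0 x y) ⟩
    (x ^ p + y ^ p) ^ (p ℕ.^ k)                 ≈⟨ ^p^k-homo-+ p-prime p×1≈0 k (x ^ p) (y ^ p) ⟩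
    (x ^ p) ^ (p ℕ.^ k) + (y ^ p) ^ (p ℕ.^ k)   ≈⟨ +-cong (^-assocʳ x p (p ℕ.^ k)) (^-assocʳ y p (p ℕ.^ k)) ⟩
    x ^ (p ℕ.* p ℕ.^ k) + y ^ (p ℕ.* p ℕ.^ k)   ∎


module FieldProperties {c ℓ} (F : Field c ℓ) where

  open import Data.Nat as ℕ using (zero; suc)
  import Data.Nat.Properties as ℕ
  open import Data.Fin as Fin using (Fin)
  open import Data.Fin.Permutation using (permutation)
  open import Data.Product using (_,_; proj₁; proj₂)
  open import Data.Empty using (⊥-elim)
  open import Relation.Nullary using (¬_; yes; no)
  open import Relation.Binary.Definitions using (Decidable)
  open import Relation.Binary.PropositionalEquality as ≡ using (_≡_)
  open import Algebra.Morphism.Structures using (IsRingHomomorphism)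
  open Field F
  open import Algebra.Properties.Ring ring using (x+x≈x⇒x≈0; +-identityˡ-unique; +-inverseʳ-unique)
  open import Algebra.Properties.Semiring.Mult semiring using (_×_; ×1-homo-*)
  open import Algebra.Properties.Semiring.Exp semiring using (_^_; ^-congˡ)
  open import Algebra.Properties.CommutativeSemiring.Exp commutativeSemiring using (^-distrib-*)
  open import Algebra.Properties.CommutativeMonoid.Sum +-commutativeMonoid
    using (sum; sum-permute; sum-cong-≋; ∑-distrib-+; sum-replicate)
  open import Relation.Binary.Reasoning.Setoid setoid
  open IntegerSolver commutativeRing using (solve; _:=_; _:+_; :-_)

  infix 8 _⁻¹[_]
  _⁻¹[_] : ∀ x → ¬ x ≈ 0# → Carrier
  x ⁻¹[ x≉0 ] = proj₁ (inverse x x≉0)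

  x*x⁻¹≈1 : ∀ {x} (x≉0 : ¬ x ≈ 0#) → x * x ⁻¹[ x≉0 ] ≈ 1#
  x*x⁻¹≈1 {x} x≉0 = proj₂ (inverse x x≉0)

  x≈k*y⇒k⁻¹*x≈y : ∀ {k x y} (k≉0 : ¬ k ≈ 0#) → x ≈ k * y → k ⁻¹[ k≉0 ] * x ≈ y
  x≈k*y⇒k⁻¹*x≈y {k} {x} {y} k≉0 x≈k*y = begin
    k ⁻¹[ k≉0 ] * x         ≈⟨ *-congˡ x≈k*y ⟩
    k ⁻¹[ k≉0 ] * (k * y)   ≈⟨ sym (*-assoc _ _ _) ⟩
    k ⁻¹[ k≉0 ] * k * y     ≈⟨ *-congʳ (trans (*-comm _ _) (x*x⁻¹≈1 k≉0)) ⟩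
    1# * y                  ≈⟨ *-identityˡ y ⟩
    y                       ∎

  x≉0∧x*y≈0⇒y≈0 : ∀ {x y} → ¬ x ≈ 0# → x * y ≈ 0# → y ≈ 0#
  x≉0∧x*y≈0⇒y≈0 {x} {y} x≉0 x*y≈0 = trans (sym (x≈k*y⇒k⁻¹*x≈y x≉0 refl)) (trans (*-congˡ x*y≈0) (zeroʳ _))

  x≉0∧y≉0⇒x*y≉0 : ∀ {x y} → ¬ x ≈ 0# → ¬ y ≈ 0# → ¬ x * y ≈ 0#
  x≉0∧y≉0⇒x*y≉0 x≉0 y≉0 x*y≈0 = y≉0 (x≉0∧x*y≈0⇒y≈0 x≉0 x*y≈0)

  x≉0∧y≉0∧z≉0⇒x*y*z≉0 : ∀ {x y z} → ¬ x ≈ 0# → ¬ y ≈ 0# → ¬ z ≈ 0# → ¬ x * y * z ≈ 0#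
  x≉0∧y≉0∧z≉0⇒x*y*z≉0 x≉0 y≉0 z≉0 = x≉0∧y≉0⇒x*y≉0 (x≉0∧y≉0⇒x*y≉0 x≉0 y≉0) z≉0

  x⁻¹≉0 : ∀ {x} (x≉0 : ¬ x ≈ 0#) → ¬ x ⁻¹[ x≉0 ] ≈ 0#
  x⁻¹≉0 {x} x≉0 x⁻¹≈0 = 0≉1 (begin
    0#               ≈⟨ sym (zeroʳ x) ⟩
    x * 0#           ≈⟨ *-congˡ (sym x⁻¹≈0) ⟩
    x * x ⁻¹[ x≉0 ]  ≈⟨ x*x⁻¹≈1 x≉0 ⟩
    1#               ∎)

  x≉0⇒x^n≉0 : ∀ {x} n → ¬ x ≈ 0# → ¬ x ^ n ≈ 0#
  x≉0⇒x^n≉0 zero    _   1≈0 = 0≉1 (sym 1≈0)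
  x≉0⇒x^n≉0 (suc n) x≉0     = x≉0∧y≉0⇒x*y≉0 x≉0 (x≉0⇒x^n≉0 n x≉0)

  ×1-homo-^ : ∀ m n → (m ℕ.^ n) × 1# ≈ (m × 1#) ^ n
  ×1-homo-^ m zero    = +-identityʳ 1#
  ×1-homo-^ m (suc n) = trans (×1-homo-* m (m ℕ.^ n)) (*-congˡ (×1-homo-^ m n))

  1^n≈1 : ∀ n → 1# ^ n ≈ 1#
  1^n≈1 zero    = refl
  1^n≈1 (suc n) = trans (*-identityˡ _) (1^n≈1 n)

  additive-multiplicative⇒isRingHomomorphism :
    ∀ {σ} → (∀ {x y} → x ≈ y → σ x ≈ σ y) → (∀ x y → σ (x + y) ≈ σ x + σ y) →
    (∀ x y → σ (x * y) ≈ σ x * σ y) → σ 1# ≈ 1# → IsRingHomomorphism rawRing rawRing σ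
  additive-multiplicative⇒isRingHomomorphism {σ} σ-cong +-homo *-homo 1#-homo = record
    { isSemiringHomomorphism = record
      { isNearSemiringHomomorphism = record
        { +-isMonoidHomomorphism = record
          { isMagmaHomomorphism = record { isRelHomomorphism = record { cong = σ-cong } ; homo = +-homo }
          ; ε-homo = 0#-homo
          }
        ; *-homo = *-homo
        }
      ; 1#-homo = 1#-homo
      }
    ; -‿homo = λ x → +-inverseʳ-unique (σ x) (σ (- x)) (begin
        σ x + σ (- x)  ≈⟨ sym (+-homo x (- x)) ⟩
        σ (x - x)      ≈⟨ σ-cong (-‿inverseʳ x) ⟩
        σ 0#           ≈⟨ 0#-homo ⟩
        0#             ∎)
    }
    where
    0#-homo : σ 0# ≈ 0#
    0#-homo = x+x≈x⇒x≈0 (σ 0#) (trans (sym (+-homo 0# 0#)) (σ-cong (+-identityˡ 0#)))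

  module _ {σ} (σ-isRingHomomorphism : IsRingHomomorphism rawRing rawRing σ) where
    open IsRingHomomorphism σ-isRingHomomorphism

    homomorphism-preserves-≉0 : ∀ {x} → ¬ x ≈ 0# → ¬ σ x ≈ 0#
    homomorphism-preserves-≉0 {x} x≉0 σx≈0 = 0≉1 (begin
      0#                          ≈⟨ sym (zeroˡ _) ⟩
      0# * σ (x ⁻¹[ x≉0 ])        ≈⟨ *-congʳ (sym σx≈0) ⟩
      σ x * σ (x ⁻¹[ x≉0 ])       ≈⟨ sym (*-homo _ _) ⟩
      σ (x * x ⁻¹[ x≉0 ])         ≈⟨ ⟦⟧-cong (x*x⁻¹≈1 x≉0) ⟩
      σ 1#                        ≈⟨ 1#-homo ⟩
      1#                          ∎)

  module Finite {n} (size : HasSize F n) where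

    private
      enum : Fin n → Carrier
      enum = proj₁ size
      enum-injective : ∀ i j → enum i ≈ enum j → i ≡ j
      enum-injective = proj₁ (proj₂ size)
      index : Carrier → Fin n
      index x = proj₁ (proj₂ (proj₂ size) x)
      enum-index : ∀ x → enum (index x) ≈ x
      enum-index x = proj₂ (proj₂ (proj₂ size) x)

    infix 4 _≟_
    _≟_ : Decidable _≈_
    x ≟ y with index x Fin.≟ index y
    ... | yes i≡j = yes (trans (sym (enum-index x)) (trans (reflexive (≡.cong enum i≡j)) (enum-index y)))
    ... | no  i≢j = no λ x≈y → i≢j (enum-injective _ _ (trans (enum-index x) (trans x≈y (sym (enum-index y)))))

    -- Translation by 1# permutes the n elements, so their sum S satisfies S ≈ n × 1# + S.
    n×1≈0 : n × 1# ≈ 0#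
    n×1≈0 = +-identityˡ-unique (n × 1#) S (sym (begin
      S                              ≈⟨ sum-permute enum shift ⟩
      sum (λ i → enum (index (1# + enum i))) ≈⟨ sum-cong-≋ (λ i → enum-index (1# + enum i)) ⟩
      sum (λ i → 1# + enum i)        ≈⟨ ∑-distrib-+ {n} (λ _ → 1#) enum ⟩
      sum {n} (λ _ → 1#) + S         ≈⟨ +-congʳ (sum-replicate n) ⟩
      n × 1# + S                     ∎))
      where
      S = sum enum
      shift = permutation (λ i → index (1# + enum i)) (λ i → index (enum i - 1#))
        (λ i → enum-injective _ _ (begin
          enum (index (1# + enum (index (enum i - 1#)))) ≈⟨ enum-index _ ⟩
          1# + enum (index (enum i - 1#))               ≈⟨ +-congˡ (enum-index _) ⟩
          1# + (enum i - 1#)                            ≈⟨ solve 2 (λ a b → a :+ (b :+ :- a) := b) refl 1# (enum i) ⟩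
          enum i                                        ∎))
        (λ i → enum-injective _ _ (begin
          enum (index (enum (index (1# + enum i)) - 1#)) ≈⟨ enum-index _ ⟩
          enum (index (1# + enum i)) - 1#               ≈⟨ +-congʳ (enum-index _) ⟩
          (1# + enum i) - 1#                            ≈⟨ solve 2 (λ a b → (a :+ b) :+ :- a := b) refl 1# (enum i) ⟩
          enum i                                        ∎))

    m^j×1≈0⇒m×1≈0 : ∀ m j → (m ℕ.^ j) × 1# ≈ 0# → m × 1# ≈ 0#
    m^j×1≈0⇒m×1≈0 m j m^j×1≈0 with m × 1# ≟ 0#
    ... | yes m×1≈0 = m×1≈0
    ... | no  m×1≉0 = ⊥-elim (x≉0⇒x^n≉0 j m×1≉0 (trans (sym (×1-homo-^ m j)) m^j×1≈0))

  ^q-isRingHomomorphism : ∀ {q} → IsPrimePower q → HasSize F (q ℕ.* q) → IsRingHomomorphism rawRing rawRing (_^ q)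
  ^q-isRingHomomorphism (p , k , p-prime , ≡.refl) size =
    additive-multiplicative⇒isRingHomomorphism (^-congˡ q) (^p^k-homo-+ p-prime p×1≈0 (suc k)) (λ x y → ^-distrib-* x y q) (1^n≈1 q)
    where
    open Finite size using (n×1≈0; m^j×1≈0⇒m×1≈0)
    open Frobenius commutativeSemiring using (^p^k-homo-+)
    q : ℕ
    q = p ℕ.^ suc k
    p×1≈0 : p × 1# ≈ 0#
    p×1≈0 = m^j×1≈0⇒m×1≈0 p (suc k ℕ.+ suc k)
              (trans (reflexive (≡.cong (_× 1#) (ℕ.^-distribˡ-+-* p (suc k) (suc k)))) n×1≈0)


module CyclicProducts {c ℓ} (R : CommutativeRing c ℓ) where

  open CommutativeRing R
  open import Algebra.Properties.Ring ring using (+-inverseˡ-unique; -0#≈0#)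
  open import Relation.Binary.Reasoning.Setoid setoid
  open IntegerSolver R using (solve; _:=_; _:+_; _:*_; :-_; con)
  open import Data.Integer using (0ℤ)

  x+x′≈0⇒xyz+x′y′z′≈0 : ∀ {x x′ y y′ z z′} → x + x′ ≈ 0# → y + y′ ≈ 0# → z + z′ ≈ 0# →
                         x * y * z + x′ * y′ * z′ ≈ 0#
  x+x′≈0⇒xyz+x′y′z′≈0 {x} {x′} {y} {y′} {z} {z′} x+x′≈0 y+y′≈0 z+z′≈0 = begin
    x * y * z + x′ * y′ * z′         ≈⟨ +-congʳ (*-cong (*-cong (+-inverseˡ-unique x x′ x+x′≈0) (+-inverseˡ-unique y y′ y+y′≈0))
                                                         (+-inverseˡ-unique z z′ z+z′≈0)) ⟩
    - x′ * - y′ * - z′ + x′ * y′ * z′ ≈⟨ solve 3 (λ x′ y′ z′ → :- x′ :* :- y′ :* :- z′ :+ x′ :* y′ :* z′ := con 0ℤ) refl x′ y′ z′ ⟩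
    0#                               ∎

  cyclic-products-cancel :
    ∀ {μ ν ρ τ φ ψ μ′ ν′ ρ′ τ′ φ′ ψ′ hab hba hbc hcb hca hac} →
    μ * ρ * φ + ν * τ * ψ ≈ 0# → μ′ * ρ′ * φ′ + ν′ * τ′ * ψ′ ≈ 0# →
    μ * ν′ * hbc + ν * μ′ * hcb ≈ 0# → ρ * τ′ * hca + τ * ρ′ * hac ≈ 0# → φ * ψ′ * hab + ψ * φ′ * hba ≈ 0# →
    ν * τ * ψ * (ν′ * τ′ * ψ′) * (hab * hbc * hca + hba * hcb * hac) ≈ 0#
  cyclic-products-cancel {μ} {ν} {ρ} {τ} {φ} {ψ} {μ′} {ν′} {ρ′} {τ′} {φ′} {ψ′} {hab} {hba} {hbc} {hcb} {hca} {hac}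
                         m+n≈0 m′+n′≈0 X+X′≈0 Y+Y′≈0 Z+Z′≈0 = begin
    n * n′ * (T + T′)                  ≈⟨ solve 4 (λ n n′ T T′ → n :* n′ :* (T :+ T′) := :- (:- n :* n′ :* T :+ n :* :- n′ :* T′)) refl n n′ T T′ ⟩
    - (- n * n′ * T + n * - n′ * T′)  ≈⟨ -‿cong (+-cong (*-congʳ (*-congʳ (sym (+-inverseˡ-unique m n m+n≈0))))
                                                         (*-congʳ (*-congˡ (sym (+-inverseˡ-unique m′ n′ m′+n′≈0))))) ⟩
    - (m * n′ * T + n * m′ * T′)      ≈⟨ -‿cong (+-cong (solve 9 (λ μ ρ φ ν′ τ′ ψ′ hab hbc hca →
                                                                (μ :* ρ :* φ) :* (ν′ :* τ′ :* ψ′) :* (hab :* hbc :* hca) :=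
                                                                (μ :* ν′ :* hbc) :* (ρ :* τ′ :* hca) :* (φ :* ψ′ :* hab))
                                                              refl μ ρ φ ν′ τ′ ψ′ hab hbc hca)
                                                        (solve 9 (λ ν τ ψ μ′ ρ′ φ′ hba hcb hac →
                                                                (ν :* τ :* ψ) :* (μ′ :* ρ′ :* φ′) :* (hba :* hcb :* hac) :=
                                                                (ν :* μ′ :* hcb) :* (τ :* ρ′ :* hac) :* (ψ :* φ′ :* hba))
                                                              refl ν τ ψ μ′ ρ′ φ′ hba hcb hac)) ⟩
    - (X * Y * Z + X′ * Y′ * Z′)      ≈⟨ -‿cong (x+x′≈0⇒xyz+x′y′z′≈0 X+X′≈0 Y+Y′≈0 Z+Z′≈0) ⟩
    - 0#                               ≈⟨ -0#≈0# ⟩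
    0#                                 ∎
    where
    m n m′ n′ T T′ X X′ Y Y′ Z Z′ : Carrier
    m  = μ * ρ * φ
    n  = ν * τ * ψ
    m′ = μ′ * ρ′ * φ′
    n′ = ν′ * τ′ * ψ′
    T  = hab * hbc * hca
    T′ = hba * hcb * hac
    X  = μ * ν′ * hbc
    X′ = ν * μ′ * hcb
    Y  = ρ * τ′ * hca
    Y′ = τ * ρ′ * hac
    Z  = φ * ψ′ * hab
    Z′ = ψ * φ′ * hba

-- Generic in the carrier so that the same definitions, instantiated at solver polynomials,
-- let vector identities over V3 be proved by solve … refl.
module Vector3 {a v} {A : Set a} {V : Set v}
  (vec : A → A → A → V) (x y z : V → A) (_+_ _*_ : A → A → A) (-_ : A → A) where

  infixl 7 _∙_
  infixl 6 _⊕_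
  infix  9 _⨯_
  infix  8 _·_

  _·_ : V → V → A
  u · v = ((x u * x v) + (y u * y v)) + (z u * z v)

  _⨯_ : V → V → V
  u ⨯ v = vec ((y u * z v) + (- (z u * y v))) ((z u * x v) + (- (x u * z v))) ((x u * y v) + (- (y u * x v)))

  det : V → V → V → A
  det u v w = u · (v ⨯ w)

  _∙_ : A → V → V
  k ∙ u = vec (k * x u) (k * y u) (k * z u)

  _⊕_ : V → V → V
  u ⊕ v = vec (x u + x v) (y u + y v) (z u + z v)


module ProjectivePlane {c ℓ} (F : Field c ℓ) (q : ℕ) (_≟_ : Decidable (Field._≈_ F)) where

  open import Data.Product using (_×_; _,_; proj₁; proj₂)
  open import Data.Sum using (_⊎_; inj₁; inj₂)
  open import Data.Empty using (⊥; ⊥-elim)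
  open import Relation.Nullary using (¬_; Dec; yes; no)
  open import Relation.Nullary.Decidable using (_×-dec_)
  open import Algebra.Morphism.Structures using (IsRingHomomorphism)
  open Field F
  open import Algebra.Properties.Semiring.Exp semiring using (_^_)
  open import Algebra.Properties.Ring ring using (x∙y⁻¹≈ε⇒x≈y; -0#≈0#)
  open import Relation.Binary.Reasoning.Setoid setoid
  open FieldProperties F
  open CyclicProducts commutativeRing using (cyclic-products-cancel)
  open Hermitian F q
  open IntegerSolver commutativeRing using (solve; _:=_; _:+_; _:*_; :-_; con; Polynomial)
  open import Data.Integer using (0ℤ)
  open Vector3 ⟨_,_,_⟩ x y z _+_ _*_ -_ public
  module P {n} = Vector3 {A = Polynomial n} (λ a b c → a , b , c) proj₁ (λ u → proj₁ (proj₂ u)) (λ u → proj₂ (proj₂ u)) _:+_ _:*_ :-_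

  infix 4 _≋_
  _≋_ : V3 → V3 → Set ℓ
  u ≋ v = x u ≈ x v × y u ≈ y v × z u ≈ z v

  𝟎 : V3
  𝟎 = ⟨ 0# , 0# , 0# ⟩

  ≋-refl : ∀ {u} → u ≋ u
  ≋-refl = refl , refl , refl

  ≋-sym : ∀ {u v} → u ≋ v → v ≋ u
  ≋-sym (e₁ , e₂ , e₃) = sym e₁ , sym e₂ , sym e₃

  ≋-trans : ∀ {u v w} → u ≋ v → v ≋ w → u ≋ w
  ≋-trans (e₁ , e₂ , e₃) (f₁ , f₂ , f₃) = trans e₁ f₁ , trans e₂ f₂ , trans e₃ f₃

  ·-cong : ∀ {u u′ v v′} → u ≋ u′ → v ≋ v′ → u · v ≈ u′ · v′
  ·-cong (e₁ , e₂ , e₃) (f₁ , f₂ , f₃) = +-cong (+-cong (*-cong e₁ f₁) (*-cong e₂ f₂)) (*-cong e₃ f₃)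

  ⨯-cong : ∀ {u u′ v v′} → u ≋ u′ → v ≋ v′ → u ⨯ v ≋ u′ ⨯ v′
  ⨯-cong (e₁ , e₂ , e₃) (f₁ , f₂ , f₃) =
    minor e₂ f₃ e₃ f₂ , minor e₃ f₁ e₁ f₃ , minor e₁ f₂ e₂ f₁
    where
    minor : ∀ {a a′ b b′ c c′ d d′} → a ≈ a′ → b ≈ b′ → c ≈ c′ → d ≈ d′ → a * b - c * d ≈ a′ * b′ - c′ * d′
    minor a≈ b≈ c≈ d≈ = +-cong (*-cong a≈ b≈) (-‿cong (*-cong c≈ d≈))

  det-cong : ∀ {u u′ v v′ w w′} → u ≋ u′ → v ≋ v′ → w ≋ w′ → det u v w ≈ det u′ v′ w′
  det-cong u≋ v≋ w≋ = ·-cong u≋ (⨯-cong v≋ w≋)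

  ·-comm : ∀ u v → u · v ≈ v · u
  ·-comm u v = +-cong (+-cong (*-comm _ _) (*-comm _ _)) (*-comm _ _)

  ·-zeroʳ : ∀ t → t · 𝟎 ≈ 0#
  ·-zeroʳ t = trans (+-cong (+-cong (zeroʳ _) (zeroʳ _)) (zeroʳ _)) (trans (+-identityʳ _) (+-identityʳ _))

  private
    e₁·≈x : ∀ w → ⟨ 1# , 0# , 0# ⟩ · w ≈ x w
    e₁·≈x w = trans (+-cong (+-cong (*-identityˡ _) (zeroˡ _)) (zeroˡ _)) (trans (+-identityʳ _) (+-identityʳ _))
    e₂·≈y : ∀ w → ⟨ 0# , 1# , 0# ⟩ · w ≈ y w
    e₂·≈y w = trans (+-cong (+-cong (zeroˡ _) (*-identityˡ _)) (zeroˡ _)) (trans (+-identityʳ _) (+-identityˡ _))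
    e₃·≈z : ∀ w → ⟨ 0# , 0# , 1# ⟩ · w ≈ z w
    e₃·≈z w = trans (+-cong (+-cong (zeroˡ _) (zeroˡ _)) (*-identityˡ _)) (trans (+-congʳ (+-identityˡ _)) (+-identityˡ _))

  ·-injective : ∀ {u v} → (∀ t → t · u ≈ t · v) → u ≋ v
  ·-injective {u} {v} t·u≈t·v = along e₁·≈x , along e₂·≈y , along e₃·≈z
    where
    along : ∀ {e} {s : V3 → Carrier} → (∀ w → e · w ≈ s w) → s u ≈ s v
    along {e} e·≈s = trans (sym (e·≈s u)) (trans (t·u≈t·v e) (e·≈s v))

  ≋𝟎? : ∀ u → Dec (u ≋ 𝟎)
  ≋𝟎? u = (x u ≟ 0#) ×-dec (y u ≟ 0#) ×-dec (z u ≟ 0#)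

  ∙≋𝟎⇒≈0 : ∀ {k u} → NonZero u → k ∙ u ≋ 𝟎 → k ≈ 0#
  ∙≋𝟎⇒≈0 {k} u≠0 (e₁ , e₂ , e₃) with k ≟ 0#
  ... | yes k≈0 = k≈0
  ... | no  k≉0 = ⊥-elim (u≠0 (x≉0∧x*y≈0⇒y≈0 k≉0 e₁ , x≉0∧x*y≈0⇒y≈0 k≉0 e₂ , x≉0∧x*y≈0⇒y≈0 k≉0 e₃))

  ⨯-orthogonalˡ : ∀ u v → (u ⨯ v) · u ≈ 0#
  ⨯-orthogonalˡ u v = solve 6 (λ u₁ u₂ u₃ v₁ v₂ v₃ →
    let u = u₁ , u₂ , u₃ ; v = v₁ , v₂ , v₃ in (u P.⨯ v) P.· u := con 0ℤ)
    refl (x u) (y u) (z u) (x v) (y v) (z v)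

  ⨯-orthogonalʳ : ∀ u v → (u ⨯ v) · v ≈ 0#
  ⨯-orthogonalʳ u v = solve 6 (λ u₁ u₂ u₃ v₁ v₂ v₃ →
    let u = u₁ , u₂ , u₃ ; v = v₁ , v₂ , v₃ in (u P.⨯ v) P.· v := con 0ℤ)
    refl (x u) (y u) (z u) (x v) (y v) (z v)

  det-cyclic : ∀ a b c → det a b c ≈ det b c a
  det-cyclic a b c = solve 9 (λ a₁ a₂ a₃ b₁ b₂ b₃ c₁ c₂ c₃ →
    let a = a₁ , a₂ , a₃ ; b = b₁ , b₂ , b₃ ; c = c₁ , c₂ , c₃ in P.det a b c := P.det b c a)
    refl (x a) (y a) (z a) (x b) (y b) (z b) (x c) (y c) (z c)

  det-scale : ∀ k₁ k₂ k₃ u v w → det (k₁ ∙ u) (k₂ ∙ v) (k₃ ∙ w) ≈ k₁ * k₂ * k₃ * det u v w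
  det-scale k₁ k₂ k₃ u v w = solve 12 (λ k₁ k₂ k₃ u₁ u₂ u₃ v₁ v₂ v₃ w₁ w₂ w₃ →
    let u = u₁ , u₂ , u₃ ; v = v₁ , v₂ , v₃ ; w = w₁ , w₂ , w₃ in
    P.det (k₁ P.∙ u) (k₂ P.∙ v) (k₃ P.∙ w) := k₁ :* k₂ :* k₃ :* P.det u v w)
    refl k₁ k₂ k₃ (x u) (y u) (z u) (x v) (y v) (z v) (x w) (y w) (z w)

  det-side-points : ∀ μ ν ρ τ φ ψ a b c →
               det (μ ∙ b ⊕ ν ∙ c) (ρ ∙ c ⊕ τ ∙ a) (φ ∙ a ⊕ ψ ∙ b) ≈ det a b c * (μ * ρ * φ + ν * τ * ψ)
  det-side-points μ ν ρ τ φ ψ a b c = solve 15 (λ μ ν ρ τ φ ψ a₁ a₂ a₃ b₁ b₂ b₃ c₁ c₂ c₃ →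
    let a = a₁ , a₂ , a₃ ; b = b₁ , b₂ , b₃ ; c = c₁ , c₂ , c₃ in
    P.det (μ P.∙ b P.⊕ ν P.∙ c) (ρ P.∙ c P.⊕ τ P.∙ a) (φ P.∙ a P.⊕ ψ P.∙ b) := P.det a b c :* (μ :* ρ :* φ :+ ν :* τ :* ψ))
    refl μ ν ρ τ φ ψ (x a) (y a) (z a) (x b) (y b) (z b) (x c) (y c) (z c)

  det-mul : ∀ a b c a′ b′ c′ →
            det a b c * det a′ b′ c′ ≈
            det ⟨ a · a′ , a · b′ , a · c′ ⟩ ⟨ b · a′ , b · b′ , b · c′ ⟩ ⟨ c · a′ , c · b′ , c · c′ ⟩
  det-mul a b c a′ b′ c′ = solve 18 (λ a₁ a₂ a₃ b₁ b₂ b₃ c₁ c₂ c₃ a₁′ a₂′ a₃′ b₁′ b₂′ b₃′ c₁′ c₂′ c₃′ →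
    let a = a₁ , a₂ , a₃ ; b = b₁ , b₂ , b₃ ; c = c₁ , c₂ , c₃
        a′ = a₁′ , a₂′ , a₃′ ; b′ = b₁′ , b₂′ , b₃′ ; c′ = c₁′ , c₂′ , c₃′ in
    P.det a b c :* P.det a′ b′ c′ :=
    P.det (a P.· a′ , a P.· b′ , a P.· c′) (b P.· a′ , b P.· b′ , b P.· c′) (c P.· a′ , c P.· b′ , c P.· c′))
    refl (x a) (y a) (z a) (x b) (y b) (z b) (x c) (y c) (z c) (x a′) (y a′) (z a′) (x b′) (y b′) (z b′) (x c′) (y c′) (z c′)

  det-zero-diagonal : ∀ p q r s t u →
                      det ⟨ 0# , p , q ⟩ ⟨ r , 0# , s ⟩ ⟨ t , u , 0# ⟩ ≈ p * s * t + r * u * q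
  det-zero-diagonal = solve 6 (λ p q r s t u →
    P.det (con 0ℤ , p , q) (r , con 0ℤ , s) (t , u , con 0ℤ) := p :* s :* t :+ r :* u :* q) refl

  ·-∙∙ : ∀ k u k′ u′ → (k ∙ u) · (k′ ∙ u′) ≈ k * k′ * (u · u′)
  ·-∙∙ k u k′ u′ = solve 8 (λ k u₁ u₂ u₃ k′ u₁′ u₂′ u₃′ →
    let u = u₁ , u₂ , u₃ ; u′ = u₁′ , u₂′ , u₃′ in (k P.∙ u) P.· (k′ P.∙ u′) := k :* k′ :* (u P.· u′))
    refl k (x u) (y u) (z u) k′ (x u′) (y u′) (z u′)

  ·-bilinear : ∀ α β v w α′ β′ v′ w′ →
               (α ∙ v ⊕ β ∙ w) · (α′ ∙ v′ ⊕ β′ ∙ w′) ≈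
               α * α′ * (v · v′) + α * β′ * (v · w′) + β * α′ * (w · v′) + β * β′ * (w · w′)
  ·-bilinear α β v w α′ β′ v′ w′ = solve 16 (λ α β v₁ v₂ v₃ w₁ w₂ w₃ α′ β′ v₁′ v₂′ v₃′ w₁′ w₂′ w₃′ →
    let v = v₁ , v₂ , v₃ ; w = w₁ , w₂ , w₃ ; v′ = v₁′ , v₂′ , v₃′ ; w′ = w₁′ , w₂′ , w₃′ in
    (α P.∙ v P.⊕ β P.∙ w) P.· (α′ P.∙ v′ P.⊕ β′ P.∙ w′) :=
    α :* α′ :* (v P.· v′) :+ α :* β′ :* (v P.· w′) :+ β :* α′ :* (w P.· v′) :+ β :* β′ :* (w P.· w′))
    refl α β (x v) (y v) (z v) (x w) (y w) (z w) α′ β′ (x v′) (y v′) (z v′) (x w′) (y w′) (z w′)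

  Prop-sym : ∀ {v w} → Prop v w → Prop w v
  Prop-sym (k , k≉0 , e₁ , e₂ , e₃) = k ⁻¹[ k≉0 ] , x⁻¹≉0 k≉0 , flip e₁ , flip e₂ , flip e₃
    where
    flip : ∀ {s t} → s ≈ k * t → t ≈ k ⁻¹[ k≉0 ] * s
    flip s≈k*t = sym (x≈k*y⇒k⁻¹*x≈y k≉0 s≈k*t)

  Prop-trans : ∀ {u v w} → Prop u v → Prop v w → Prop u w
  Prop-trans (k , k≉0 , e₁ , e₂ , e₃) (l , l≉0 , f₁ , f₂ , f₃) =
    k * l , x≉0∧y≉0⇒x*y≉0 k≉0 l≉0 , compose e₁ f₁ , compose e₂ f₂ , compose e₃ f₃
    where
    compose : ∀ {r s t} → r ≈ k * s → s ≈ l * t → r ≈ k * l * t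
    compose r≈k*s s≈l*t = trans r≈k*s (trans (*-congˡ s≈l*t) (sym (*-assoc _ _ _)))

  ≋∙⇒Prop : ∀ {k u v} → NonZero u → u ≋ k ∙ v → Prop u v
  ≋∙⇒Prop {k} {u} {v} u≠0 u≋k∙v@(e₁ , e₂ , e₃) = k , k≉0 , u≋k∙v
    where
    k≉0 : ¬ k ≈ 0#
    k≉0 k≈0 = u≠0 (vanish e₁ , vanish e₂ , vanish e₃)
      where
      vanish : ∀ {s t} → s ≈ k * t → s ≈ 0#
      vanish s≈k*t = trans s≈k*t (trans (*-congʳ k≈0) (zeroˡ _))

  scaled⇒Prop : ∀ {k l u v} → ¬ k ≈ 0# → NonZero u → k ∙ u ≋ l ∙ v → Prop u v
  scaled⇒Prop {k} {l} k≉0 u≠0 (e₁ , e₂ , e₃) = ≋∙⇒Prop u≠0 (divide e₁ , divide e₂ , divide e₃)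
    where
    divide : ∀ {s t} → k * s ≈ l * t → s ≈ k ⁻¹[ k≉0 ] * l * t
    divide k*s≈l*t = trans (sym (x≈k*y⇒k⁻¹*x≈y k≉0 (sym k*s≈l*t))) (sym (*-assoc _ _ _))

  private
    rotate : V3 → V3
    rotate u = ⟨ y u , z u , x u ⟩

    unrotate : ∀ {u v} → rotate u ≋ rotate v → u ≋ v
    unrotate (e₁ , e₂ , e₃) = e₃ , e₁ , e₂

    rotate-⨯≋𝟎 : ∀ {u v} → u ⨯ v ≋ 𝟎 → rotate u ⨯ rotate v ≋ 𝟎
    rotate-⨯≋𝟎 (e₁ , e₂ , e₃) = e₂ , e₃ , e₁

    ⨯≋𝟎⇒x∙≋x∙ : ∀ {u v} → u ⨯ v ≋ 𝟎 → x u ∙ v ≋ x v ∙ u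
    ⨯≋𝟎⇒x∙≋x∙ (_ , e₂ , e₃) =
      *-comm _ _ ,
      trans (x∙y⁻¹≈ε⇒x≈y _ _ e₃) (*-comm _ _) ,
      trans (sym (x∙y⁻¹≈ε⇒x≈y _ _ e₂)) (*-comm _ _)

  ⨯≋𝟎⇒Prop : ∀ {u v} → NonZero u → NonZero v → u ⨯ v ≋ 𝟎 → Prop v u
  ⨯≋𝟎⇒Prop {u} u≠0 v≠0 u⨯v≋𝟎 with x u ≟ 0# | y u ≟ 0# | z u ≟ 0#
  ... | no x≉0 | _      | _      = scaled⇒Prop x≉0 v≠0 (⨯≋𝟎⇒x∙≋x∙ u⨯v≋𝟎)
  ... | yes _  | no y≉0 | _      = scaled⇒Prop y≉0 v≠0 (unrotate (⨯≋𝟎⇒x∙≋x∙ (rotate-⨯≋𝟎 u⨯v≋𝟎)))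
  ... | yes _  | yes _  | no z≉0 = scaled⇒Prop z≉0 v≠0 (unrotate (unrotate (⨯≋𝟎⇒x∙≋x∙ (rotate-⨯≋𝟎 (rotate-⨯≋𝟎 u⨯v≋𝟎)))))
  ... | yes x≈0 | yes y≈0 | yes z≈0 = ⊥-elim (u≠0 (x≈0 , y≈0 , z≈0))

  private
    zero-combination : ∀ {a b} s t → a ≈ 0# → b ≈ 0# → a * s - b * t ≈ 0#
    zero-combination s t a≈0 b≈0 =
      trans (+-cong (trans (*-congʳ a≈0) (zeroˡ s)) (-‿cong (trans (*-congʳ b≈0) (zeroˡ t))))
            (trans (+-identityˡ _) -0#≈0#)

  ⨯⨯≋𝟎 : ∀ {P Q L} → On P L → On Q L → (P ⨯ Q) ⨯ L ≋ 𝟎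
  ⨯⨯≋𝟎 {P} {Q} {L} P∈L Q∈L = ·-injective λ t → begin
    t · ((P ⨯ Q) ⨯ L)                 ≈⟨ expand t ⟩
    (L · P) * (t · Q) - (L · Q) * (t · P) ≈⟨ zero-combination _ _ P∈L Q∈L ⟩
    0#                                ≈⟨ sym (·-zeroʳ t) ⟩
    t · 𝟎                             ∎
    where
    expand : ∀ t → t · ((P ⨯ Q) ⨯ L) ≈ (L · P) * (t · Q) - (L · Q) * (t · P)
    expand t = solve 12 (λ p₁ p₂ p₃ q₁ q₂ q₃ l₁ l₂ l₃ t₁ t₂ t₃ →
      let P = p₁ , p₂ , p₃ ; Q = q₁ , q₂ , q₃ ; L = l₁ , l₂ , l₃ ; t = t₁ , t₂ , t₃ in
      t P.· ((P P.⨯ Q) P.⨯ L) := (L P.· P) :* (t P.· Q) :+ :- ((L P.· Q) :* (t P.· P)))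
      refl (x P) (y P) (z P) (x Q) (y Q) (z Q) (x L) (y L) (z L) (x t) (y t) (z t)

  two-common-points : ∀ {L M P Q} → NonZero L → NonZero M → NonZero P → NonZero Q →
                      On P L → On Q L → On P M → On Q M → Prop Q P ⊎ Prop L M
  two-common-points {P = P} {Q} L≠0 M≠0 P≠0 Q≠0 P∈L Q∈L P∈M Q∈M with ≋𝟎? (P ⨯ Q)
  ... | yes P⨯Q≋𝟎 = inj₁ (⨯≋𝟎⇒Prop P≠0 Q≠0 P⨯Q≋𝟎)
  ... | no  P⨯Q≠0 = inj₂ (Prop-trans (⨯≋𝟎⇒Prop P⨯Q≠0 L≠0 (⨯⨯≋𝟎 P∈L Q∈L))
                                     (Prop-sym (⨯≋𝟎⇒Prop P⨯Q≠0 M≠0 (⨯⨯≋𝟎 P∈M Q∈M))))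

  meet-unique : ∀ {L M P Q} → ¬ Prop L M → NonZero L → NonZero M → Meet L M P → Meet L M Q → Prop P Q
  meet-unique L≁M L≠0 M≠0 (P≠0 , P∈L , P∈M) (Q≠0 , Q∈L , Q∈M)
    with two-common-points L≠0 M≠0 P≠0 Q≠0 P∈L Q∈L P∈M Q∈M
  ... | inj₁ Q∼P = Prop-sym Q∼P
  ... | inj₂ L∼M = ⊥-elim (L≁M L∼M)

  ≁-sym : ∀ {u v} → ¬ Prop u v → ¬ Prop v u
  ≁-sym u≁v v∼u = u≁v (Prop-sym v∼u)

  ≁-resp-Prop : ∀ {u u′ v v′} → ¬ Prop u′ v′ → Prop u u′ → Prop v v′ → ¬ Prop u v
  ≁-resp-Prop u′≁v′ u∼u′ v∼v′ u∼v = u′≁v′ (Prop-trans (Prop-sym u∼u′) (Prop-trans u∼v v∼v′))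

  NonDegenerate⇒distinct : ∀ {L M N P Q R} → NonZero L → NonZero M → NonZero N →
                           ¬ Prop L M → ¬ Prop M N → ¬ Prop L N →
                           Meet L M P → Meet M N Q → Meet L N R → NonDegenerate L M N →
                           ¬ Prop P Q × ¬ Prop Q R × ¬ Prop P R
  NonDegenerate⇒distinct {P = P} {Q} {R} L≠0 M≠0 N≠0 L≁M M≁N L≁N P∈LM Q∈MN R∈LN
                         (P′ , Q′ , R′ , P′∈LM , Q′∈MN , R′∈LN , P′≁Q′ , Q′≁R′ , P′≁R′) =
    ≁-resp-Prop P′≁Q′ P∼P′ Q∼Q′ , ≁-resp-Prop Q′≁R′ Q∼Q′ R∼R′ , ≁-resp-Prop P′≁R′ P∼P′ R∼R′
    where
    P∼P′ : Prop P P′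
    P∼P′ = meet-unique L≁M L≠0 M≠0 P∈LM P′∈LM
    Q∼Q′ : Prop Q Q′
    Q∼Q′ = meet-unique M≁N M≠0 N≠0 Q∈MN Q′∈MN
    R∼R′ : Prop R R′
    R∼R′ = meet-unique L≁N L≠0 N≠0 R∈LN R′∈LN

  collinear⇒det≈0 : ∀ {L u v w} → NonZero L → On u L → On v L → On w L → det u v w ≈ 0#
  collinear⇒det≈0 {L} {u} {v} {w} L≠0 u∈L v∈L w∈L = ∙≋𝟎⇒≈0 L≠0 (·-injective λ t → begin
    t · (det u v w ∙ L)                                                  ≈⟨ adjugate t ⟩
    (L · u) * (t · (v ⨯ w)) + (L · v) * (t · (w ⨯ u)) + (L · w) * (t · (u ⨯ v))
      ≈⟨ +-cong (+-cong (vanish u∈L) (vanish v∈L)) (vanish w∈L) ⟩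
    0# + 0# + 0#                                                         ≈⟨ trans (+-identityʳ _) (+-identityʳ _) ⟩
    0#                                                                   ≈⟨ sym (·-zeroʳ t) ⟩
    t · 𝟎                                                                ∎)
    where
    vanish : ∀ {a s} → a ≈ 0# → a * s ≈ 0#
    vanish a≈0 = trans (*-congʳ a≈0) (zeroˡ _)
    adjugate : ∀ t → t · (det u v w ∙ L) ≈ (L · u) * (t · (v ⨯ w)) + (L · v) * (t · (w ⨯ u)) + (L · w) * (t · (u ⨯ v))
    adjugate t = solve 15 (λ u₁ u₂ u₃ v₁ v₂ v₃ w₁ w₂ w₃ l₁ l₂ l₃ t₁ t₂ t₃ →
      let u = u₁ , u₂ , u₃ ; v = v₁ , v₂ , v₃ ; w = w₁ , w₂ , w₃ ; L = l₁ , l₂ , l₃ ; t = t₁ , t₂ , t₃ in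
      t P.· (P.det u v w P.∙ L) := (L P.· u) :* (t P.· (v P.⨯ w)) :+ (L P.· v) :* (t P.· (w P.⨯ u)) :+ (L P.· w) :* (t P.· (u P.⨯ v)))
      refl (x u) (y u) (z u) (x v) (y v) (z v) (x w) (y w) (z w) (x L) (y L) (z L) (x t) (y t) (z t)

  triangle⇒det≉0 : ∀ {L M a b c} → NonZero L → NonZero M → NonZero a → NonZero b → NonZero c →
                   On b L → On c L → On a M → On b M →
                   ¬ Prop c b → ¬ Prop b a → ¬ Prop L M → ¬ det a b c ≈ 0#
  triangle⇒det≉0 {L} {M} {a} {b} {c} L≠0 M≠0 a≠0 b≠0 c≠0 b∈L c∈L a∈M b∈M c≁b b≁a L≁M det≈0
    with ≋𝟎? (b ⨯ c)
  ... | yes b⨯c≋𝟎 = c≁b (⨯≋𝟎⇒Prop b≠0 c≠0 b⨯c≋𝟎)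
  ... | no  b⨯c≠0 =
    both-lines-are-b⨯c
      (two-common-points {L} {b ⨯ c} {b} {c} L≠0 b⨯c≠0 b≠0 c≠0 b∈L c∈L (⨯-orthogonalˡ b c) (⨯-orthogonalʳ b c))
      (two-common-points {M} {b ⨯ c} {a} {b} M≠0 b⨯c≠0 a≠0 b≠0 a∈M b∈M (trans (·-comm (b ⨯ c) a) det≈0) (⨯-orthogonalˡ b c))
    where
    both-lines-are-b⨯c : Prop c b ⊎ Prop L (b ⨯ c) → Prop b a ⊎ Prop M (b ⨯ c) → ⊥
    both-lines-are-b⨯c (inj₁ c∼b) _          = c≁b c∼b
    both-lines-are-b⨯c (inj₂ _)   (inj₁ b∼a) = b≁a b∼a
    both-lines-are-b⨯c (inj₂ L∼N) (inj₂ M∼N) = L≁M (Prop-trans L∼N (Prop-sym M∼N))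

  cramer : ∀ a b c d → det d b c ≈ 0# → det a b c ∙ d ≋ det a d c ∙ b ⊕ det a b d ∙ c
  cramer a b c d det-dbc≈0 = ·-injective λ t → begin
    t · (det a b c ∙ d)                                         ≈⟨ expand t ⟩
    det d b c * (t · a) + t · (det a d c ∙ b ⊕ det a b d ∙ c)  ≈⟨ +-congʳ (trans (*-congʳ det-dbc≈0) (zeroˡ _)) ⟩
    0# + t · (det a d c ∙ b ⊕ det a b d ∙ c)                   ≈⟨ +-identityˡ _ ⟩
    t · (det a d c ∙ b ⊕ det a b d ∙ c)                        ∎
    where
    expand : ∀ t → t · (det a b c ∙ d) ≈ det d b c * (t · a) + t · (det a d c ∙ b ⊕ det a b d ∙ c)
    expand t = solve 15 (λ a₁ a₂ a₃ b₁ b₂ b₃ c₁ c₂ c₃ d₁ d₂ d₃ t₁ t₂ t₃ →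
      let a = a₁ , a₂ , a₃ ; b = b₁ , b₂ , b₃ ; c = c₁ , c₂ , c₃ ; d = d₁ , d₂ , d₃ ; t = t₁ , t₂ , t₃ in
      t P.· (P.det a b c P.∙ d) := P.det d b c :* (t P.· a) :+ t P.· (P.det a d c P.∙ b P.⊕ P.det a b d P.∙ c))
      refl (x a) (y a) (z a) (x b) (y b) (z b) (x c) (y c) (z c) (x d) (y d) (z d) (x t) (y t) (z t)

  second-coefficient≈0⇒Prop : ∀ {Δ α β u v w} → ¬ Δ ≈ 0# → NonZero u →
                               Δ ∙ u ≋ α ∙ v ⊕ β ∙ w → β ≈ 0# → Prop u v
  second-coefficient≈0⇒Prop {β = β} Δ≉0 u≠0 (e₁ , e₂ , e₃) β≈0 = scaled⇒Prop Δ≉0 u≠0 (drop e₁ , drop e₂ , drop e₃)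
    where
    drop : ∀ {r s t} → r ≈ s + β * t → r ≈ s
    drop r≈ = trans r≈ (trans (+-congˡ (trans (*-congʳ β≈0) (zeroˡ _))) (+-identityʳ _))

  menelaus : ∀ {a b c d e f Δ₁ Δ₂ Δ₃ μ ν ρ τ φ ψ} → ¬ det a b c ≈ 0# →
             Δ₁ ∙ d ≋ μ ∙ b ⊕ ν ∙ c → Δ₂ ∙ e ≋ ρ ∙ c ⊕ τ ∙ a → Δ₃ ∙ f ≋ φ ∙ a ⊕ ψ ∙ b →
             det d e f ≈ 0# → μ * ρ * φ + ν * τ * ψ ≈ 0#
  menelaus {a} {b} {c} {d} {e} {f} {Δ₁} {Δ₂} {Δ₃} {μ} {ν} {ρ} {τ} {φ} {ψ} Δ≉0 d≋ e≋ f≋ def≈0 =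
    x≉0∧x*y≈0⇒y≈0 Δ≉0 (begin
      det a b c * (μ * ρ * φ + ν * τ * ψ)                     ≈⟨ sym (det-side-points μ ν ρ τ φ ψ a b c) ⟩
      det (μ ∙ b ⊕ ν ∙ c) (ρ ∙ c ⊕ τ ∙ a) (φ ∙ a ⊕ ψ ∙ b)    ≈⟨ sym (det-cong d≋ e≋ f≋) ⟩
      det (Δ₁ ∙ d) (Δ₂ ∙ e) (Δ₃ ∙ f)                         ≈⟨ det-scale Δ₁ Δ₂ Δ₃ d e f ⟩
      Δ₁ * Δ₂ * Δ₃ * det d e f                              ≈⟨ *-congˡ def≈0 ⟩
      Δ₁ * Δ₂ * Δ₃ * 0#                                     ≈⟨ zeroʳ _ ⟩
      0#                                                    ∎)

  module Unital (^q-isRingHomomorphism : IsRingHomomorphism rawRing rawRing (_^ q)) where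

    open IsRingHomomorphism ^q-isRingHomomorphism
      renaming (⟦⟧-cong to σ-cong; +-homo to σ-homo-+; *-homo to σ-homo-*; 0#-homo to σ-homo-0#; -‿homo to σ-homo-neg)

    σ : Carrier → Carrier
    σ a = a ^ q

    σᵛ : V3 → V3
    σᵛ u = ⟨ σ (x u) , σ (y u) , σ (z u) ⟩

    herm : V3 → V3 → Carrier
    herm u v = u · σᵛ v

    Isotropic : V3 → Set ℓ
    Isotropic u = herm u u ≈ 0#

    σ-≉0 : ∀ {r} → ¬ r ≈ 0# → ¬ σ r ≈ 0#
    σ-≉0 = homomorphism-preserves-≉0 ^q-isRingHomomorphism

    σᵛ-cong : ∀ {u v} → u ≋ v → σᵛ u ≋ σᵛ v
    σᵛ-cong (e₁ , e₂ , e₃) = σ-cong e₁ , σ-cong e₂ , σ-cong e₃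

    σᵛ-homo-∙ : ∀ k u → σᵛ (k ∙ u) ≋ σ k ∙ σᵛ u
    σᵛ-homo-∙ k u = σ-homo-* _ _ , σ-homo-* _ _ , σ-homo-* _ _

    σᵛ-homo-∙⊕∙ : ∀ α v β w → σᵛ (α ∙ v ⊕ β ∙ w) ≋ σ α ∙ σᵛ v ⊕ σ β ∙ σᵛ w
    σᵛ-homo-∙⊕∙ α v β w = homo (x v) (x w) , homo (y v) (y w) , homo (z v) (z w)
      where
      homo : ∀ s t → σ (α * s + β * t) ≈ σ α * σ s + σ β * σ t
      homo s t = trans (σ-homo-+ _ _) (+-cong (σ-homo-* α s) (σ-homo-* β t))

    σ-homo-· : ∀ u v → σ (u · v) ≈ σᵛ u · σᵛ v
    σ-homo-· u v = trans (σ-homo-+ _ _) (+-cong (trans (σ-homo-+ _ _) (+-cong (σ-homo-* _ _) (σ-homo-* _ _))) (σ-homo-* _ _))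

    σᵛ-homo-⨯ : ∀ u v → σᵛ (u ⨯ v) ≋ σᵛ u ⨯ σᵛ v
    σᵛ-homo-⨯ u v = minor (y u) (z v) (z u) (y v) , minor (z u) (x v) (x u) (z v) , minor (x u) (y v) (y u) (x v)
      where
      minor : ∀ a b c d → σ (a * b - c * d) ≈ σ a * σ b - σ c * σ d
      minor a b c d = trans (σ-homo-+ _ _) (+-cong (σ-homo-* a b) (trans (σ-homo-neg _) (-‿cong (σ-homo-* c d))))

    σ-homo-det : ∀ a b c → σ (det a b c) ≈ det (σᵛ a) (σᵛ b) (σᵛ c)
    σ-homo-det a b c = trans (σ-homo-· a (b ⨯ c)) (·-cong ≋-refl (σᵛ-homo-⨯ b c))

    isotropic-combination : ∀ {Δ α β u v w} → Isotropic u → Isotropic v → Isotropic w →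
                            Δ ∙ u ≋ α ∙ v ⊕ β ∙ w → α * σ β * herm v w + β * σ α * herm w v ≈ 0#
    isotropic-combination {Δ} {α} {β} {u} {v} {w} u-iso v-iso w-iso Δu≋αv+βw = begin
      α * σ β * herm v w + β * σ α * herm w v
        ≈⟨ sym (trans (+-cong (+-congʳ (+-congʳ (vanish v-iso))) (vanish w-iso))
                      (trans (+-identityʳ _) (+-congʳ (+-identityˡ _)))) ⟩
      α * σ α * herm v v + α * σ β * herm v w + β * σ α * herm w v + β * σ β * herm w w
        ≈⟨ sym (·-bilinear α β v w (σ α) (σ β) (σᵛ v) (σᵛ w)) ⟩
      (α ∙ v ⊕ β ∙ w) · (σ α ∙ σᵛ v ⊕ σ β ∙ σᵛ w)
        ≈⟨ ·-cong (≋-sym Δu≋αv+βw) (≋-trans (≋-sym (σᵛ-homo-∙⊕∙ α v β w)) (σᵛ-cong (≋-sym Δu≋αv+βw))) ⟩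
      herm (Δ ∙ u) (Δ ∙ u)
        ≈⟨ ·-cong ≋-refl (σᵛ-homo-∙ Δ u) ⟩
      (Δ ∙ u) · (σ Δ ∙ σᵛ u)
        ≈⟨ ·-∙∙ Δ u (σ Δ) (σᵛ u) ⟩
      Δ * σ Δ * herm u u
        ≈⟨ vanish u-iso ⟩
      0# ∎
      where
      vanish : ∀ {k a} → a ≈ 0# → k * a ≈ 0#
      vanish a≈0 = trans (*-congˡ a≈0) (zeroʳ _)

    gram-determinant : ∀ {a b c} → Isotropic a → Isotropic b → Isotropic c →
           det a b c * σ (det a b c) ≈ herm a b * herm b c * herm c a + herm b a * herm c b * herm a c
    gram-determinant {a} {b} {c} a-iso b-iso c-iso = begin
      det a b c * σ (det a b c)
        ≈⟨ *-congˡ (σ-homo-det a b c) ⟩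
      det a b c * det (σᵛ a) (σᵛ b) (σᵛ c)
        ≈⟨ det-mul a b c (σᵛ a) (σᵛ b) (σᵛ c) ⟩
      det ⟨ herm a a , herm a b , herm a c ⟩ ⟨ herm b a , herm b b , herm b c ⟩ ⟨ herm c a , herm c b , herm c c ⟩
        ≈⟨ det-cong (a-iso , refl , refl) (refl , b-iso , refl) (refl , refl , c-iso) ⟩
      det ⟨ 0# , herm a b , herm a c ⟩ ⟨ herm b a , 0# , herm b c ⟩ ⟨ herm c a , herm c b , 0# ⟩
        ≈⟨ det-zero-diagonal _ _ _ _ _ _ ⟩
      herm a b * herm b c * herm c a + herm b a * herm c b * herm a c ∎

    σ-homo-cubic : ∀ μ ν ρ τ φ ψ → μ * ρ * φ + ν * τ * ψ ≈ 0# → σ μ * σ ρ * σ φ + σ ν * σ τ * σ ψ ≈ 0#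
    σ-homo-cubic μ ν ρ τ φ ψ m+n≈0 = begin
      σ μ * σ ρ * σ φ + σ ν * σ τ * σ ψ ≈⟨ sym (+-cong (homo-*³ μ ρ φ) (homo-*³ ν τ ψ)) ⟩
      σ (μ * ρ * φ) + σ (ν * τ * ψ)     ≈⟨ sym (σ-homo-+ _ _) ⟩
      σ (μ * ρ * φ + ν * τ * ψ)         ≈⟨ σ-cong m+n≈0 ⟩
      σ 0#                              ≈⟨ σ-homo-0# ⟩
      0#                                ∎
      where
      homo-*³ : ∀ r s t → σ (r * s * t) ≈ σ r * σ s * σ t
      homo-*³ r s t = trans (σ-homo-* _ _) (*-congʳ (σ-homo-* r s))

    isotropic-menelaus-configuration-impossible :
      ∀ {a b c d e f} → Isotropic a → Isotropic b → Isotropic c → Isotropic d → Isotropic e → Isotropic f →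
      NonZero d → NonZero e → NonZero f → ¬ det a b c ≈ 0# →
      det d b c ≈ 0# → det e c a ≈ 0# → det f a b ≈ 0# → det d e f ≈ 0# →
      ¬ Prop d b → ¬ Prop e c → ¬ Prop f a → ⊥
    isotropic-menelaus-configuration-impossible {a} {b} {c} {d} {e} {f}
      a-iso b-iso c-iso d-iso e-iso f-iso d≠0 e≠0 f≠0 Δ≉0 dbc≈0 eca≈0 fab≈0 def≈0 d≁b e≁c f≁a =
      x≉0∧y≉0⇒x*y≉0 Δ≉0 (σ-≉0 Δ≉0) (begin
        det a b c * σ (det a b c)
          ≈⟨ gram-determinant a-iso b-iso c-iso ⟩
        herm a b * herm b c * herm c a + herm b a * herm c b * herm a c
          ≈⟨ x≉0∧x*y≈0⇒y≈0 ντψ·σντψ≉0 (cyclic-products-cancel m+n≈0 (σ-homo-cubic _ _ _ _ _ _ m+n≈0)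
               (isotropic-combination d-iso b-iso c-iso d-on-bc)
               (isotropic-combination e-iso c-iso a-iso e-on-ca)
               (isotropic-combination f-iso a-iso b-iso f-on-ab)) ⟩
        0# ∎)
      where
      d-on-bc : det a b c ∙ d ≋ det a d c ∙ b ⊕ det a b d ∙ c
      d-on-bc = cramer a b c d dbc≈0
      e-on-ca : det b c a ∙ e ≋ det b e a ∙ c ⊕ det b c e ∙ a
      e-on-ca = cramer b c a e eca≈0
      f-on-ab : det c a b ∙ f ≋ det c f b ∙ a ⊕ det c a f ∙ b
      f-on-ab = cramer c a b f fab≈0
      m+n≈0 : det a d c * det b e a * det c f b + det a b d * det b c e * det c a f ≈ 0#
      m+n≈0 = menelaus Δ≉0 d-on-bc e-on-ca f-on-ab def≈0
      Δ₂≉0 : ¬ det b c a ≈ 0#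
      Δ₂≉0 Δ₂≈0 = Δ≉0 (trans (det-cyclic a b c) Δ₂≈0)
      Δ₃≉0 : ¬ det c a b ≈ 0#
      Δ₃≉0 Δ₃≈0 = Δ₂≉0 (trans (det-cyclic b c a) Δ₃≈0)
      ν≉0 : ¬ det a b d ≈ 0#
      ν≉0 ν≈0 = d≁b (second-coefficient≈0⇒Prop Δ≉0 d≠0 d-on-bc ν≈0)
      τ≉0 : ¬ det b c e ≈ 0#
      τ≉0 τ≈0 = e≁c (second-coefficient≈0⇒Prop Δ₂≉0 e≠0 e-on-ca τ≈0)
      ψ≉0 : ¬ det c a f ≈ 0#
      ψ≉0 ψ≈0 = f≁a (second-coefficient≈0⇒Prop Δ₃≉0 f≠0 f-on-ab ψ≈0)
      ντψ·σντψ≉0 : ¬ det a b d * det b c e * det c a f * (σ (det a b d) * σ (det b c e) * σ (det c a f)) ≈ 0#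
      ντψ·σντψ≉0 = x≉0∧y≉0⇒x*y≉0 (x≉0∧y≉0∧z≉0⇒x*y*z≉0 ν≉0 τ≉0 ψ≉0) (x≉0∧y≉0∧z≉0⇒x*y*z≉0 (σ-≉0 ν≉0) (σ-≉0 τ≉0) (σ-≉0 ψ≉0))

    no-K4-of-nondegenerate-triangles : ∀ L₁ L₂ L₃ L₄ → K4 L₁ L₂ L₃ L₄ →
                                       ¬ (InT L₁ L₂ L₃ × InT L₁ L₂ L₄ × InT L₁ L₃ L₄ × InT L₂ L₃ L₄)
    no-K4-of-nondegenerate-triangles L₁ L₂ L₃ L₄
      ((L₁≠0 , _) , (L₂≠0 , _) , (L₃≠0 , _) , (L₄≠0 , _) ,
       (L₁≁L₂ , c , c∈L₁L₂@(c≠0 , c∈L₁ , c∈L₂) , _ , c-iso) ,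
       (L₁≁L₃ , b , b∈L₁L₃@(b≠0 , b∈L₁ , b∈L₃) , _ , b-iso) ,
       (L₁≁L₄ , d , d∈L₁L₄@(d≠0 , d∈L₁ , d∈L₄) , _ , d-iso) ,
       (L₂≁L₃ , a , a∈L₂L₃@(a≠0 , a∈L₂ , a∈L₃) , _ , a-iso) ,
       (L₂≁L₄ , e , e∈L₂L₄@(e≠0 , e∈L₂ , e∈L₄) , _ , e-iso) ,
       (L₃≁L₄ , f , f∈L₃L₄@(f≠0 , f∈L₃ , f∈L₄) , _ , f-iso))
      ((_ , nd₁₂₃) , (_ , nd₁₂₄) , (_ , nd₁₃₄) , (_ , nd₂₃₄)) =
      isotropic-menelaus-configuration-impossible a-iso b-iso c-iso d-iso e-iso f-iso d≠0 e≠0 f≠0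
        (triangle⇒det≉0 L₁≠0 L₃≠0 a≠0 b≠0 c≠0 b∈L₁ c∈L₁ a∈L₃ b∈L₃ c≁b b≁a L₁≁L₃)
        (collinear⇒det≈0 L₁≠0 d∈L₁ b∈L₁ c∈L₁) (collinear⇒det≈0 L₂≠0 e∈L₂ c∈L₂ a∈L₂)
        (collinear⇒det≈0 L₃≠0 f∈L₃ a∈L₃ b∈L₃) (collinear⇒det≈0 L₄≠0 d∈L₄ e∈L₄ f∈L₄)
        d≁b e≁c f≁a
      where
      c≁a∧a≁b∧c≁b : ¬ Prop c a × ¬ Prop a b × ¬ Prop c b
      c≁a∧a≁b∧c≁b = NonDegenerate⇒distinct L₁≠0 L₂≠0 L₃≠0 L₁≁L₂ L₂≁L₃ L₁≁L₃ c∈L₁L₂ a∈L₂L₃ b∈L₁L₃ nd₁₂₃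
      c≁b : ¬ Prop c b
      c≁b = proj₂ (proj₂ c≁a∧a≁b∧c≁b)
      b≁a : ¬ Prop b a
      b≁a = ≁-sym (proj₁ (proj₂ c≁a∧a≁b∧c≁b))
      d≁b : ¬ Prop d b
      d≁b = ≁-sym (proj₂ (proj₂ (NonDegenerate⇒distinct L₁≠0 L₃≠0 L₄≠0 L₁≁L₃ L₃≁L₄ L₁≁L₄ b∈L₁L₃ f∈L₃L₄ d∈L₁L₄ nd₁₃₄)))
      e≁c : ¬ Prop e c
      e≁c = ≁-sym (proj₁ (NonDegenerate⇒distinct L₁≠0 L₂≠0 L₄≠0 L₁≁L₂ L₂≁L₄ L₁≁L₄ c∈L₁L₂ e∈L₂L₄ d∈L₁L₄ nd₁₂₄))
      f≁a : ¬ Prop f a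
      f≁a = ≁-sym (proj₁ (NonDegenerate⇒distinct L₂≠0 L₃≠0 L₄≠0 L₂≁L₃ L₃≁L₄ L₂≁L₄ a∈L₂L₃ f∈L₃L₄ e∈L₂L₄ nd₂₃₄))


open import Level using (Level)
open import Data.Nat using (_*_)
open import Data.Product using (_×_)
open import Relation.Nullary using (¬_)

mainTheorem3 : ∀ {c ℓ : Level} (q : ℕ) → IsPrimePower q →
    (F : Field c ℓ) → HasSize F (q * q) →
    let open Hermitian F q in
    ∀ L₁ L₂ L₃ L₄ → K4 L₁ L₂ L₃ L₄ →
    ¬ (InT L₁ L₂ L₃ × InT L₁ L₂ L₄ × InT L₁ L₃ L₄ × InT L₂ L₃ L₄)
mainTheorem3 q q-prime-power F size = no-K4-of-nondegenerate-triangles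
  where
  open FieldProperties F using (^q-isRingHomomorphism; module Finite)
  open Finite size using (_≟_)
  open ProjectivePlane F q _≟_
  open Unital (^q-isRingHomomorphism q-prime-power size)
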